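{- The calculi $\mathtt{LSkG}$ and $\mathtt{LSkT}$ are equivalent in the following sense: (1) for every derivable $\mathtt{LSkG}$ sequent $S \mid \Gamma \vdash C$, the $\mathtt{LSkT}$ sequent $\llbracket s(S) \mid \Gamma \rrbracket \vdash C$ is derivable in $\mathtt{LSkT}$; (2) for every derivable $\mathtt{LSkT}$ sequent $T \vdash C$, the $\mathtt{LSkG}$ sequent $T^* \mid\ \vdash C$ (stoup $T^*$, empty context) is derivable in $\mathtt{LSkG}$.
   Context: Formulae are generated by $A,B ::= X \mid \mathsf{I} \mid A \otimes B \mid A \multimap B$, with $X$ ranging over a set of atoms. $\mathtt{LSkG}$: sequents $S \mid \Gamma \vdash A$, where the stoup $S$ is a formula or empty ($S={ - }$), $\Gamma$ a finite ordered list of formulae, $A$ a formula. Rules: (ax) $A \mid\ \vdash A$; ($\multimap$L) from ${ - } \mid \Gamma \vdash A$ and $B \mid \Delta \vdash C$ infer $A \multimap B \mid \Gamma,\Delta \vdash C$; (IL) from ${ - } \mid \Gamma \vdash C$ infer $\mathsf{I} \mid \Gamma \vdash C$; ($\otimes$L) from $A \mid B,\Gamma \vdash C$ infer $A\otimes B \mid \Gamma \vdash C$; (pass) from $A \mid \Gamma \vdash C$ infer ${ - } \mid A,\Gamma \vdash C$; ($\multimap$R) from $S \mid \Gamma, A \vdash B$ infer $S \mid \Gamma \vdash A \multimap B$; (IR) ${ - } \mid\ \vdash \mathsf{I}$; ($\otimes$R) from $S \mid \Gamma \vdash A$ and ${ - } \mid \Delta \vdash B$ infer $S \mid \Gamma,\Delta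 \vdash A \otimes B$. $\mathtt{LSkT}$: trees $T ::= A \mid { - } \mid (T,T)$ (${ - }$ the empty tree); contexts $\mathcal{C} ::= [\cdot] \mid (\mathcal{C},T) \mid (T,\mathcal{C})$, with $T[U]$ the substitution of tree $U$ into the hole. Sequents $T \vdash A$. Rules: (ax) $A \vdash A$; (IL) from $T[{ - }] \vdash C$ infer $T[\mathsf{I}] \vdash C$; (IR) ${ - } \vdash \mathsf{I}$; ($\otimes$L) from $T[A,B] \vdash C$ infer $T[A\otimes B] \vdash C$; ($\otimes$R) from $T \vdash A$ and $U \vdash B$ infer $T,U \vdash A \otimes B$; ($\multimap$L) from $U \vdash A$ and $T[B] \vdash C$ infer $T[A\multimap B, U] \vdash C$; ($\multimap$R) from $T, A \vdash B$ infer $T \vdash A \multimap B$; (assoc) from $T[U_0,(U_1,U_2)] \vdash C$ infer $T[(U_0,U_1),U_2] \vdash C$; (unitL) from $T[U] \vdash C$ infer $T[{ - },U] \vdash C$; (unitR) from $T[U,{ - }] \vdash C$ infer $T[U] \vdash C$. Notation: $s(S) = \mathsf{I}$ if $S = { - }$ and $s(S)=B$ if $S$ is the formula $B$. For a tree $T$ and a list of formulae $\Gamma$, $\llbracket T \mid [\,] \rrbracket = T$ and $\llbracket T \mid B,\Gamma \rrbracket = \llbracket (T,B) \mid \Gamma \rrbracket$ (a left-associated tree). For a tree $T$, $T^*$ is the formula with $A^*=A$, ${ - }^*=\mathsf{I}$, $(T_1,T_2)^* = T_1^*\otimes T_2^*$. -}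

module Defs where

open import Data.List using (List; []; _∷_; _++_)
open import Data.Product using (_×_)

module _ (At : Set) where

  data Fma : Set where
    ` : At → Fma
    I : Fma
    _⊗_ : Fma → Fma → Fma
    _⊸_ : Fma → Fma → Fma

  infixr 25 _⊗_
  infixr 20 _⊸_

  data Stp : Set where
    ─ : Stp
    just : Fma → Stp

  Cxt : Set
  Cxt = List Fma

  infix 5 _∣_⊢G_
  infix 5 _⊢T_

  data _∣_⊢G_ : Stp → Cxt → Fma → Set where
    ax : ∀ {A} → just A ∣ [] ⊢G A
    ⊸L : ∀ {Γ Δ A B C} → ─ ∣ Γ ⊢G A → just B ∣ Δ ⊢G C → just (A ⊸ B) ∣ Γ ++ Δ ⊢G C
    IL : ∀ {Γ C} → ─ ∣ Γ ⊢G C → just I ∣ Γ ⊢G C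
    ⊗L : ∀ {Γ A B C} → just A ∣ B ∷ Γ ⊢G C → just (A ⊗ B) ∣ Γ ⊢G C
    pass : ∀ {Γ A C} → just A ∣ Γ ⊢G C → ─ ∣ A ∷ Γ ⊢G C
    ⊸R : ∀ {S Γ A B} → S ∣ Γ ++ (A ∷ []) ⊢G B → S ∣ Γ ⊢G A ⊸ B
    IR : ─ ∣ [] ⊢G I
    ⊗R : ∀ {S Γ Δ A B} → S ∣ Γ ⊢G A → ─ ∣ Δ ⊢G B → S ∣ Γ ++ Δ ⊢G A ⊗ B

  data Tree : Set where
    leaf : Fma → Tree
    ─ : Tree
    _,_ : Tree → Tree → Tree

  data TCxt : Set where
    ∙ : TCxt
    _◂_ : TCxt → Tree → TCxt
    _▸_ : Tree → TCxt → TCxt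

  infix 30 _[_]
  infixr 10 _,_

  _[_] : TCxt → Tree → Tree
  ∙ [ U ] = U
  (C ◂ T) [ U ] = (C [ U ] , T)
  (T ▸ C) [ U ] = (T , C [ U ])

  data _⊢T_ : Tree → Fma → Set where
    ax : ∀ {A} → leaf A ⊢T A
    IL : ∀ {𝒞 C} → 𝒞 [ ─ ] ⊢T C → 𝒞 [ leaf I ] ⊢T C
    IR : ─ ⊢T I
    ⊗L : ∀ {𝒞 A B C} → 𝒞 [ (leaf A , leaf B) ] ⊢T C → 𝒞 [ leaf (A ⊗ B) ] ⊢T C
    ⊗R : ∀ {T U A B} → T ⊢T A → U ⊢T B → (T , U) ⊢T A ⊗ B
    ⊸L : ∀ {𝒞 U A B C} → U ⊢T A → 𝒞 [ leaf B ] ⊢T C → 𝒞 [ (leaf (A ⊸ B) , U) ] ⊢T C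
    ⊸R : ∀ {T A B} → (T , leaf A) ⊢T B → T ⊢T A ⊸ B
    assoc : ∀ {𝒞 U₀ U₁ U₂ C} → 𝒞 [ (U₀ , (U₁ , U₂)) ] ⊢T C → 𝒞 [ ((U₀ , U₁) , U₂) ] ⊢T C
    unitL : ∀ {𝒞 U C} → 𝒞 [ U ] ⊢T C → 𝒞 [ (─ , U) ] ⊢T C
    unitR : ∀ {𝒞 U C} → 𝒞 [ (U , ─) ] ⊢T C → 𝒞 [ U ] ⊢T C

  s : Stp → Fma
  s ─ = I
  s (just A) = A

  ⟦_∣_⟧ : Tree → Cxt → Tree
  ⟦ T ∣ [] ⟧ = T
  ⟦ T ∣ B ∷ Γ ⟧ = ⟦ (T , leaf B) ∣ Γ ⟧

  _* : Tree → Fma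
  leaf A * = A
  ─ * = I
  (T₁ , T₂) * = (T₁ *) ⊗ (T₂ *)

{-# OPTIONS --safe #-}
module Submission where

-- (1) Read the stoup as a tree (─ or a leaf); an LSkG sequent S ∣ Γ ⊢ C then becomes
-- the left-associated tree ⟦ S ∣ Γ ⟧.  LSkT rules apply anywhere in a tree, and such a
-- replacement step U ↝ V can be transported along a spine ⟦ - ∣ Γ ⟧, so the LSkG left
-- rules are LSkT rules applied at the bottom of the spine.  The rules ⊗R and ⊸L merge a
-- second spine ⟦ ─ ∣ Δ ⟧ into the first, by repeated assoc and a final unitR; an empty
-- stoup is finally turned into I by IL.
-- (2) Each LSkT rule applied in a context 𝒞 replaces a subtree V by U, where U* → V* is
-- a map of LSkG (an identity, an evaluation, or one of the skew monoidal structure maps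
-- λ, ρ, α).  Functoriality of ⊗ lifts it to (𝒞[U])* → (𝒞[V])*, and admissibility of
-- cut in LSkG composes it with the translated premise.

open import Data.List using (List; []; _∷_; _++_)
open import Data.List.Properties using (++-assoc; ++-identityʳ; ∷-injectiveˡ; ∷-injectiveʳ)
open import Data.Product using (_×_)
open import Function using (_∘_)
open import Relation.Binary.PropositionalEquality using (_≡_; refl; sym; trans; cong; subst)
import Defs

data ++-Split {a} {X : Set a} : List X → List X → List X → X → List X → Set a where
  inˡ : ∀ {Δ₀ x Λ Γ'} → ++-Split (Δ₀ ++ x ∷ Λ) Γ' Δ₀ x (Λ ++ Γ')
  inʳ : ∀ {Γ Λ x Δ₁} → ++-Split Γ (Λ ++ x ∷ Δ₁) (Γ ++ Λ) x Δ₁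

++-split : ∀ {a} {X : Set a} (Γ : List X) {Γ'} Δ₀ {x Δ₁} →
           Γ ++ Γ' ≡ Δ₀ ++ x ∷ Δ₁ → ++-Split Γ Γ' Δ₀ x Δ₁
++-split []      Δ₀       refl = inʳ
++-split (y ∷ Γ) []       refl = inˡ
++-split (y ∷ Γ) (z ∷ Δ₀) e with ∷-injectiveˡ e | ++-split Γ Δ₀ (∷-injectiveʳ e)
... | refl | inˡ = inˡ
... | refl | inʳ = inʳ

module Equivalence (At : Set) where

  open Defs using
    (I; _⊗_; _⊸_; ─; just; leaf; _,_; ∙; _◂_; _▸_;
     ax; ⊸L; IL; ⊗L; pass; ⊸R; IR; ⊗R; assoc; unitL; unitR)

  Fma : Set
  Fma = Defs.Fma At

  Stp : Set
  Stp = Defs.Stp At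

  Cxt : Set
  Cxt = Defs.Cxt At

  Tree : Set
  Tree = Defs.Tree At

  TCxt : Set
  TCxt = Defs.TCxt At

  infix 5 _∣_⊢G_ _⊢T_
  infix 30 _[_]

  _∣_⊢G_ : Stp → Cxt → Fma → Set
  _∣_⊢G_ = Defs._∣_⊢G_ At

  _⊢T_ : Tree → Fma → Set
  _⊢T_ = Defs._⊢T_ At

  _[_] : TCxt → Tree → Tree
  _[_] = Defs._[_] At

  ⟦_∣_⟧ : Tree → Cxt → Tree
  ⟦_∣_⟧ = Defs.⟦_∣_⟧ At

  _* : Tree → Fma
  _* = Defs._* At

  s : Stp → Fma
  s = Defs.s At

  variable
    A B C : Fma
    S : Stp
    Γ Δ : Cxt
    T U V : Tree

  stoupTree : Stp → Tree
  stoupTree ─ = ─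
  stoupTree (just A) = leaf A

  castT : T ≡ U → T ⊢T C → U ⊢T C
  castT {C = C} = subst (_⊢T C)

  _∘ᶜ_ : TCxt → TCxt → TCxt
  ∙       ∘ᶜ 𝒟 = 𝒟
  (𝒞 ◂ T) ∘ᶜ 𝒟 = (𝒞 ∘ᶜ 𝒟) ◂ T
  (T ▸ 𝒞) ∘ᶜ 𝒟 = T ▸ (𝒞 ∘ᶜ 𝒟)

  []-∘ᶜ : ∀ 𝒞 𝒟 U → (𝒞 ∘ᶜ 𝒟) [ U ] ≡ 𝒞 [ 𝒟 [ U ] ]
  []-∘ᶜ ∙       𝒟 U = refl
  []-∘ᶜ (𝒞 ◂ T) 𝒟 U = cong (λ X → X , T) ([]-∘ᶜ 𝒞 𝒟 U)
  []-∘ᶜ (T ▸ 𝒞) 𝒟 U = cong (λ X → T , X) ([]-∘ᶜ 𝒞 𝒟 U)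

  ⟦⟧-++ : ∀ T Γ Δ → ⟦ T ∣ Γ ++ Δ ⟧ ≡ ⟦ ⟦ T ∣ Γ ⟧ ∣ Δ ⟧
  ⟦⟧-++ T []      Δ = refl
  ⟦⟧-++ T (B ∷ Γ) Δ = ⟦⟧-++ (T , leaf B) Γ Δ

  infix 4 _↝_
  _↝_ : Tree → Tree → Set
  U ↝ V = ∀ {𝒞 C} → 𝒞 [ U ] ⊢T C → 𝒞 [ V ] ⊢T C

  ↝-[] : ∀ 𝒟 → U ↝ V → 𝒟 [ U ] ↝ 𝒟 [ V ]
  ↝-[] {U} {V} 𝒟 r {𝒞} =
    castT ([]-∘ᶜ 𝒞 𝒟 V) ∘ r {𝒞 ∘ᶜ 𝒟} ∘ castT (sym ([]-∘ᶜ 𝒞 𝒟 U))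

  ↝-⟦⟧ : ∀ Γ → U ↝ V → ⟦ U ∣ Γ ⟧ ↝ ⟦ V ∣ Γ ⟧
  ↝-⟦⟧ []      r = r
  ↝-⟦⟧ (B ∷ Γ) r = ↝-⟦⟧ Γ (↝-[] (∙ ◂ leaf B) r)

  reassoc-⟦⟧ : ∀ Γ → (T , ⟦ U ∣ Γ ⟧) ↝ ⟦ (T , U) ∣ Γ ⟧
  reassoc-⟦⟧ []      d = d
  reassoc-⟦⟧ (B ∷ Γ) d = ↝-⟦⟧ Γ assoc (reassoc-⟦⟧ Γ d)

  graft-⟦⟧ : ∀ Γ → (T , ⟦ ─ ∣ Γ ⟧) ↝ ⟦ T ∣ Γ ⟧
  graft-⟦⟧ Γ = ↝-⟦⟧ Γ unitR ∘ reassoc-⟦⟧ Γ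

  ⊢G⇒⊢T : S ∣ Γ ⊢G C → ⟦ stoupTree S ∣ Γ ⟧ ⊢T C
  ⊢G⇒⊢T ax = ax
  ⊢G⇒⊢T (⊸L {Γ} {Δ} f g) =
    castT (sym (⟦⟧-++ _ Γ Δ)) (↝-⟦⟧ Δ (graft-⟦⟧ Γ ∘ ⊸L (⊢G⇒⊢T f)) {∙} (⊢G⇒⊢T g))
  ⊢G⇒⊢T (IL {Γ} f) = ↝-⟦⟧ Γ IL {∙} (⊢G⇒⊢T f)
  ⊢G⇒⊢T (⊗L {Γ} f) = ↝-⟦⟧ Γ ⊗L {∙} (⊢G⇒⊢T f)
  ⊢G⇒⊢T (pass {Γ} f) = ↝-⟦⟧ Γ unitL {∙} (⊢G⇒⊢T f)
  ⊢G⇒⊢T (⊸R {Γ = Γ} f) = ⊸R (castT (⟦⟧-++ _ Γ _) (⊢G⇒⊢T f))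
  ⊢G⇒⊢T IR = IR
  ⊢G⇒⊢T (⊗R {Γ = Γ} {Δ} f g) =
    castT (sym (⟦⟧-++ _ Γ Δ)) (graft-⟦⟧ Δ {∙} (⊗R (⊢G⇒⊢T f) (⊢G⇒⊢T g)))

  stoupTree↝leaf-s : ∀ S Γ → ⟦ stoupTree S ∣ Γ ⟧ ↝ ⟦ leaf (s S) ∣ Γ ⟧
  stoupTree↝leaf-s ─        Γ = ↝-⟦⟧ Γ IL
  stoupTree↝leaf-s (just A) Γ d = d

  castG : Γ ≡ Δ → S ∣ Γ ⊢G C → S ∣ Δ ⊢G C
  castG {S = S} {C = C} = subst (λ Γ → S ∣ Γ ⊢G C)

  ++-assoc₃ : ∀ (Γ₁ Γ₂ Γ₃ Γ₄ : Cxt) → (Γ₁ ++ Γ₂ ++ Γ₃) ++ Γ₄ ≡ Γ₁ ++ Γ₂ ++ Γ₃ ++ Γ₄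
  ++-assoc₃ Γ₁ Γ₂ Γ₃ Γ₄ =
    trans (++-assoc Γ₁ (Γ₂ ++ Γ₃) Γ₄) (cong (Γ₁ ++_) (++-assoc Γ₂ Γ₃ Γ₄))

  -- Lexicographic induction on the cut formula and then the derivations.  The context
  -- of ccut is split by an explicit equation, since an index Δ₀ ++ A ∷ Δ₁ cannot be
  -- matched against.
  mutual
    scut : S ∣ Γ ⊢G A → just A ∣ Δ ⊢G C → S ∣ Γ ++ Δ ⊢G C
    scut ax g = g
    scut (⊸L {Γ₁} {Γ₂} f f') g = castG (sym (++-assoc Γ₁ Γ₂ _)) (⊸L f (scut f' g))
    scut (IL f) g = IL (scut f g)
    scut (⊗L f) g = ⊗L (scut f g)
    scut (pass f) g = pass (scut f g)
    scut {Γ = Γ} f ax = castG (sym (++-identityʳ Γ)) f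
    scut {Γ = Γ} f (⊸R {Γ = Δ} g) = ⊸R (castG (sym (++-assoc Γ Δ _)) (scut f g))
    scut {Γ = Γ} f (⊗R {Γ = Δ} {Δ'} g g') = castG (++-assoc Γ Δ Δ') (⊗R (scut f g) g')
    scut {Γ = Γ} (⊸R f) (⊸L {Γ'} {Δ'} g g') =
      castG (++-assoc₃ Γ Γ' [] Δ') (scut (ccut Γ g f refl) g')
    scut IR (IL g) = g
    scut (⊗R {Γ = Γ} {Γ'} f f') (⊗L {Γ = Δ} g) =
      castG (sym (++-assoc Γ Γ' Δ)) (scut f (ccut [] f' g refl))

    ccut : ∀ {Δ} Δ₀ {Δ₁} → ─ ∣ Γ ⊢G A → S ∣ Δ ⊢G C → Δ ≡ Δ₀ ++ A ∷ Δ₁ →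
           S ∣ Δ₀ ++ Γ ++ Δ₁ ⊢G C
    ccut []      f ax ()
    ccut (_ ∷ _) f ax ()
    ccut []      f IR ()
    ccut (_ ∷ _) f IR ()
    ccut {Γ} Δ₀ f (⊸L {Γ'} {Δ'} g g') e with ++-split Γ' Δ₀ e
    ... | inˡ {Λ = Λ} = castG (++-assoc₃ Δ₀ Γ Λ Δ') (⊸L (ccut Δ₀ f g refl) g')
    ... | inʳ {Λ = Λ} = castG (sym (++-assoc Γ' Λ _)) (⊸L g (ccut Λ f g' refl))
    ccut Δ₀ f (IL g) refl = IL (ccut Δ₀ f g refl)
    ccut Δ₀ f (⊗L {B = B} g) refl = ⊗L (ccut (B ∷ Δ₀) f g refl)
    ccut []       f (pass g) refl = scut f g
    ccut (_ ∷ Δ₀) f (pass g) refl = pass (ccut Δ₀ f g refl)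
    ccut {Γ} Δ₀ {Δ₁} f (⊸R {A = B} g) refl =
      ⊸R (castG (sym (++-assoc₃ Δ₀ Γ Δ₁ (B ∷ [])))
                (ccut Δ₀ f g (++-assoc Δ₀ _ (B ∷ []))))
    ccut {Γ} Δ₀ f (⊗R {Γ = Γ'} {Δ'} g g') e with ++-split Γ' Δ₀ e
    ... | inˡ {Λ = Λ} = castG (++-assoc₃ Δ₀ Γ Λ Δ') (⊗R (ccut Δ₀ f g refl) g')
    ... | inʳ {Λ = Λ} = castG (sym (++-assoc Γ' Λ _)) (⊗R g (ccut Λ f g' refl))

  ⊗-mapˡ : just A ∣ [] ⊢G B → just (A ⊗ C) ∣ [] ⊢G B ⊗ C
  ⊗-mapˡ f = ⊗L (⊗R f (pass ax))

  ⊗-mapʳ : just A ∣ [] ⊢G B → just (C ⊗ A) ∣ [] ⊢G C ⊗ B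
  ⊗-mapʳ f = ⊗L (⊗R ax (pass f))

  unitorˡ : just (I ⊗ A) ∣ [] ⊢G A
  unitorˡ = ⊗L (IL (pass ax))

  unitorʳ : just A ∣ [] ⊢G A ⊗ I
  unitorʳ = ⊗R ax IR

  associator : just ((A ⊗ B) ⊗ C) ∣ [] ⊢G A ⊗ (B ⊗ C)
  associator = ⊗L (⊗L (⊗R ax (⊗R (pass ax) (pass ax))))

  []-map : ∀ 𝒞 → just (U *) ∣ [] ⊢G V * → just ((𝒞 [ U ]) *) ∣ [] ⊢G (𝒞 [ V ]) *
  []-map ∙       f = f
  []-map (𝒞 ◂ T) f = ⊗-mapˡ ([]-map 𝒞 f)
  []-map (T ▸ 𝒞) f = ⊗-mapʳ ([]-map 𝒞 f)

  precompose-[] : ∀ 𝒞 {U V} → just (U *) ∣ [] ⊢G V * →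
                  just ((𝒞 [ V ]) *) ∣ [] ⊢G C → just ((𝒞 [ U ]) *) ∣ [] ⊢G C
  precompose-[] 𝒞 f = scut ([]-map 𝒞 f)

  ⊢T⇒⊢G : T ⊢T C → just (T *) ∣ [] ⊢G C
  ⊢T⇒⊢G ax = ax
  ⊢T⇒⊢G (IL {𝒞} d) = precompose-[] 𝒞 {leaf I} {─} ax (⊢T⇒⊢G d)
  ⊢T⇒⊢G IR = IL IR
  ⊢T⇒⊢G (⊗L {𝒞} {A} {B} d) =
    precompose-[] 𝒞 {leaf (A ⊗ B)} {leaf A , leaf B} ax (⊢T⇒⊢G d)
  ⊢T⇒⊢G (⊗R d e) = ⊗L (⊗R (⊢T⇒⊢G d) (pass (⊢T⇒⊢G e)))
  ⊢T⇒⊢G (⊸L {𝒞} {U} {A} {B} d e) =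
    precompose-[] 𝒞 {leaf (A ⊸ B) , U} {leaf B} (⊗L (⊸L (pass (⊢T⇒⊢G d)) ax)) (⊢T⇒⊢G e)
  ⊢T⇒⊢G (⊸R d) = ⊸R (scut (⊗R ax (pass ax)) (⊢T⇒⊢G d))
  ⊢T⇒⊢G (assoc {𝒞} {U₀} {U₁} {U₂} d) =
    precompose-[] 𝒞 {(U₀ , U₁) , U₂} {U₀ , (U₁ , U₂)} associator (⊢T⇒⊢G d)
  ⊢T⇒⊢G (unitL {𝒞} {U} d) = precompose-[] 𝒞 {─ , U} {U} unitorˡ (⊢T⇒⊢G d)
  ⊢T⇒⊢G (unitR {𝒞} {U} d) = precompose-[] 𝒞 {U} {U , ─} unitorʳ (⊢T⇒⊢G d)

open Defs using (Stp; Cxt; Fma; Tree; just; leaf; ∙; s; _∣_⊢G_; _⊢T_; ⟦_∣_⟧; _*)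
open Data.Product using (_,_)

mainTheorem4 : (At : Set)
    → (∀ (S : Stp At) (Γ : Cxt At) (C : Fma At)
         → _∣_⊢G_ At S Γ C → _⊢T_ At (⟦_∣_⟧ At (leaf (s At S)) Γ) C)
    × (∀ (T : Tree At) (C : Fma At)
         → _⊢T_ At T C → _∣_⊢G_ At (just (_* At T)) [] C)
mainTheorem4 At = (λ S Γ _ → stoupTree↝leaf-s S Γ {∙} ∘ ⊢G⇒⊢T) , (λ _ _ → ⊢T⇒⊢G)
  where open Equivalence At
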